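{- For two-stage edge-weighted bipartite matching with advice, the optimal robustness-consistency tradeoff curve is the line segment between $(R,C)=(0,1)$ and $(R,C)=(\tfrac12,\tfrac12)$. That is: for every $R\in[0,\tfrac12]$ there is an algorithm that is $R$-robust and $(1-R)$-consistent; no algorithm is more than $\tfrac12$-robust; and any $R$-robust algorithm is at most $(1-R)$-consistent.
   Context: Two-stage edge-weighted bipartite matching with advice: there is a bipartite graph $G=(D,S,E)$ with nonnegative edge weights, offline vertices $S$, and online vertices $D=D_1\cup D_2$ arriving in two batches; when batch $D_k$ arrives, its incident edges (with weights) are revealed and the algorithm irrevocably chooses a (possibly randomized) matching between $D_k$ and $S$ using offline vertices not already matched. The goal is to maximize the total weight of chosen edges; $\mathsf{ALG}(G,A)$ is the expected total weight. After the first-stage edges are revealed, the algorithm receives a suggested matching $A$ in the first-stage graph. $\mathsf{OPT}(G)$ is the maximum weight of a matching in $G$; $\mathsf{ADVICE}(G,A)$ is the weight of $A$ plus the maximum weight of a second-stage matching using only offline vertices not matched by $A$. An algorithm is $R$-robust if $\inf_{G,A}\mathsf{ALG}/\mathsf{OPT}\ge R$ and $C$-consistent if $\inf_{G,A}\mathsf{ALG}/\mathsf{ADVICE}\ge C$. -}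

module Defs where

open import Data.Nat using (ℕ; zero; suc)
open import Data.Fin using (Fin; zero; suc)
open import Data.Maybe using (Maybe; just; nothing)
import Data.List
open import Data.List using (List; []; _∷_)
open import Data.List.Relation.Unary.All using (All)
open import Data.Product using (Σ; _×_; _,_; proj₁; proj₂)
open import Data.Sum using (_⊎_)
open import Data.Empty using (⊥)
open import Relation.Nullary using (¬_)
open import Relation.Binary.PropositionalEquality using (_≡_)

-- The real numbers, axiomatised as a (Dedekind-)complete ordered field.
-- Any model of this record is isomorphic to ℝ; the theorem is stated
-- for every such model.

record RealField : Set₁ where
  infixl 6 _+_
  infixl 7 _*_
  infix 4 _≤_
  field
    ℝ : Set
    0# 1# : ℝ
    _+_ _*_ : ℝ → ℝ → ℝ
    -_ : ℝ → ℝ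
    _≤_ : ℝ → ℝ → Set
    +-assoc : ∀ x y z → (x + y) + z ≡ x + (y + z)
    +-comm : ∀ x y → x + y ≡ y + x
    +-identityˡ : ∀ x → 0# + x ≡ x
    -‿inverseˡ : ∀ x → (- x) + x ≡ 0#
    *-assoc : ∀ x y z → (x * y) * z ≡ x * (y * z)
    *-comm : ∀ x y → x * y ≡ y * x
    *-identityˡ : ∀ x → 1# * x ≡ x
    distribʳ : ∀ x y z → (x + y) * z ≡ (x * z) + (y * z)
    0≢1 : ¬ (0# ≡ 1#)
    inverse : ∀ x → ¬ (x ≡ 0#) → Σ ℝ (λ y → x * y ≡ 1#)
    ≤-refl : ∀ x → x ≤ x
    ≤-trans : ∀ {x y z} → x ≤ y → y ≤ z → x ≤ z
    ≤-antisym : ∀ {x y} → x ≤ y → y ≤ x → x ≡ y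
    ≤-total : ∀ x y → (x ≤ y) ⊎ (y ≤ x)
    +-mono-≤ : ∀ {x y} z → x ≤ y → x + z ≤ y + z
    *-nonneg : ∀ {x y} → 0# ≤ x → 0# ≤ y → 0# ≤ x * y
    sup : (P : ℝ → Set) → Σ ℝ P → Σ ℝ (λ b → ∀ x → P x → x ≤ b) →
          Σ ℝ (λ s → (∀ x → P x → x ≤ s) × (∀ b → (∀ x → P x → x ≤ b) → s ≤ b))

  _-_ : ℝ → ℝ → ℝ
  x - y = x + (- y)

module TwoStage (F : RealField) where
  open RealField F

  sumFin : (n : ℕ) → (Fin n → ℝ) → ℝ
  sumFin zero f = 0#
  sumFin (suc n) f = f zero + sumFin n (λ i → f (suc i))

  sumList : List ℝ → ℝ
  sumList [] = 0#
  sumList (x ∷ xs) = x + sumList xs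

  -- Edges between n online vertices (Fin n) and s offline vertices (Fin s):
  -- w i j = nothing  means no edge,  w i j = just x  means an edge of weight x.
  EdgeW : ℕ → ℕ → Set
  EdgeW n s = Fin n → Fin s → Maybe ℝ

  NonNeg : ∀ {n s} → EdgeW n s → Set
  NonNeg {n} {s} w = ∀ (i : Fin n) (j : Fin s) (x : ℝ) → w i j ≡ just x → 0# ≤ x

  Assign : ℕ → ℕ → Set
  Assign n s = Fin n → Maybe (Fin s)

  Uses : ∀ {n s} → Assign n s → Fin s → Set
  Uses {n} m j = Σ (Fin n) (λ i → m i ≡ just j)

  record IsMatching {n s} (w : EdgeW n s) (used : Fin s → Set) (m : Assign n s) : Set where
    field
      onEdges : ∀ i j → m i ≡ just j → Σ ℝ (λ x → w i j ≡ just x)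
      injective : ∀ i i′ j → m i ≡ just j → m i′ ≡ just j → i ≡ i′
      avoids : ∀ i j → m i ≡ just j → ¬ (used j)

  Matching1 : ∀ {n s} → EdgeW n s → Set
  Matching1 {n} {s} w = Σ (Assign n s) (IsMatching w (λ _ → ⊥))

  Matching2 : ∀ {n₁ n₂ s} {w₁ : EdgeW n₁ s} → EdgeW n₂ s → Matching1 w₁ → Set
  Matching2 {n₁} {n₂} {s} w₂ M₁ = Σ (Assign n₂ s) (IsMatching w₂ (Uses (proj₁ M₁)))

  edgeVal : Maybe ℝ → ℝ
  edgeVal (just x) = x
  edgeVal nothing = 0#

  matchVal : ∀ {s} → (Fin s → Maybe ℝ) → Maybe (Fin s) → ℝ
  matchVal row (just j) = edgeVal (row j)
  matchVal row nothing = 0#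

  weight : ∀ {n s} → EdgeW n s → Assign n s → ℝ
  weight {n} w m = sumFin n (λ i → matchVal (w i) (m i))

  -- finitely supported probability distributions, as lists of (probability, outcome)
  Dist : Set → Set
  Dist A = List (ℝ × A)

  IsDist : ∀ {A} → Dist A → Set
  IsDist d = All (λ p → 0# ≤ proj₁ p) d × sumList (Data.List.map proj₁ d) ≡ 1#

  Expect : ∀ {A} → (A → ℝ) → Dist A → ℝ
  Expect f [] = 0#
  Expect f ((p , a) ∷ d) = p * f a + Expect f d

  -- Stage 1: sees the offline vertices, the first-stage graph and the advice A,
  --   and outputs a distribution over first-stage matchings.
  -- Stage 2: additionally sees the realized first-stage matching M₁ and the
  --   second-stage graph, and outputs a distribution over second-stage
  --   matchings on the offline vertices left unmatched by M₁.
  record Algorithm : Set where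
    field
      stage1 : ∀ {n₁ s} (w₁ : EdgeW n₁ s) → Matching1 w₁ → Dist (Matching1 w₁)
      stage2 : ∀ {n₁ n₂ s} (w₁ : EdgeW n₁ s) (A : Matching1 w₁) (M₁ : Matching1 w₁)
               (w₂ : EdgeW n₂ s) → Dist (Matching2 w₂ M₁)
      stage1-valid : ∀ {n₁ s} (w₁ : EdgeW n₁ s) (A : Matching1 w₁) →
                     NonNeg w₁ → IsDist (stage1 w₁ A)
      stage2-valid : ∀ {n₁ n₂ s} (w₁ : EdgeW n₁ s) (A : Matching1 w₁) (M₁ : Matching1 w₁)
                     (w₂ : EdgeW n₂ s) → NonNeg w₁ → NonNeg w₂ → IsDist (stage2 w₁ A M₁ w₂)

  ALG : Algorithm → ∀ {n₁ n₂ s} (w₁ : EdgeW n₁ s) (w₂ : EdgeW n₂ s) → Matching1 w₁ → ℝ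
  ALG a w₁ w₂ A =
    Expect (λ M₁ → weight w₁ (proj₁ M₁)
                   + Expect (λ M₂ → weight w₂ (proj₁ M₂)) (Algorithm.stage2 a w₁ A M₁ w₂))
           (Algorithm.stage1 a w₁ A)

  -- OPT(G) is the maximum weight
  -- of a matching in G; every matching of G is a first-stage matching M₁
  -- together with a second-stage matching M₂ avoiding M₁, so this is
  -- "ALG ≥ R · weight(M)" for every matching M of G.
  Robust : Algorithm → ℝ → Set
  Robust a R = ∀ {n₁ n₂ s} (w₁ : EdgeW n₁ s) (w₂ : EdgeW n₂ s) → NonNeg w₁ → NonNeg w₂ →
               (A : Matching1 w₁) (M₁ : Matching1 w₁) (M₂ : Matching2 w₂ M₁) →
               R * (weight w₁ (proj₁ M₁) + weight w₂ (proj₁ M₂)) ≤ ALG a w₁ w₂ A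

  -- C-consistent: ALG(G,A) ≥ C · ADVICE(G,A) for all G, A, where ADVICE(G,A) is
  -- the weight of A plus the maximum weight of a second-stage matching avoiding A.
  Consistent : Algorithm → ℝ → Set
  Consistent a C = ∀ {n₁ n₂ s} (w₁ : EdgeW n₁ s) (w₂ : EdgeW n₂ s) → NonNeg w₁ → NonNeg w₂ →
                   (A : Matching1 w₁) (M₂ : Matching2 w₂ A) →
                   C * (weight w₁ (proj₁ A) + weight w₂ (proj₁ M₂)) ≤ ALG a w₁ w₂ A

-- The hedging algorithm plays, in stage one, the empty matching with probability R,
-- a maximum-weight first-stage matching with probability R and the advice with
-- probability 1 - 2R, and then completes optimally; each of the three choices
-- covers one part of the optimum (the second stage, the first stage, or the
-- advice's total), giving R-robustness and (1 - R)-consistency.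
-- Conversely, take one offline vertex and a first-stage edge of weight 1, and
-- let p be the probability that the algorithm uses it.  With an empty second
-- stage, robustness gives R ≤ p and consistency (for the advice using the edge)
-- gives C ≤ p; with a second-stage edge of arbitrarily large weight W,
-- R W ≤ p + (1 - p) W forces R + p ≤ 1.

module Submission where

open import Defs
open import Level using (0ℓ)
open import Data.Nat using (zero; suc)
open import Data.Fin using (Fin; zero; suc; _≟_)
open import Data.Fin.Properties using (0≢1+n; suc-injective; any?)
open import Data.Maybe using (just; nothing)
open import Data.Maybe.Properties using (≡-dec)
open import Data.List using (tabulate)
import Data.List
import Data.List.Relation.Unary.All
open Data.List.Relation.Unary.All using (All)
open import Data.List.Relation.Unary.All.Properties using (tabulate⁺; tabulate⁻)
import Data.List.Extrema
open import Data.Product using (Σ; _×_; _,_; proj₁; proj₂)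
open import Data.Sum using (_⊎_; inj₁; inj₂)
open import Data.Empty using (⊥-elim)
open import Relation.Nullary using (¬_; yes; no)
open import Relation.Unary using (Pred; Decidable; ｛_｝; _∪_)
open import Relation.Unary.Properties using (_∪?_; ∅?)
open import Relation.Binary.PropositionalEquality
open import Relation.Binary.Bundles using (TotalOrder)
open import Relation.Binary.Structures using (IsTotalOrder)
open import Algebra.Bundles using (CommutativeRing)
open import Algebra.Structures using (IsCommutativeRing)
import Algebra.Solver.Ring.NaturalCoefficients.Default as SemiringSolver
import Relation.Binary.Reasoning.PartialOrder as PosetReasoning

-- Defs gives _-_ no fixity, so it binds tighter than _+_ and _*_.
module OrderedFieldProperties (F : RealField) where
  open RealField F

  +-identityʳ : ∀ x → x + 0# ≡ x
  +-identityʳ x = trans (+-comm x 0#) (+-identityˡ x)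

  -‿inverseʳ : ∀ x → x + (- x) ≡ 0#
  -‿inverseʳ x = trans (+-comm x (- x)) (-‿inverseˡ x)

  *-identityʳ : ∀ x → x * 1# ≡ x
  *-identityʳ x = trans (*-comm x 1#) (*-identityˡ x)

  distribˡ : ∀ x y z → x * (y + z) ≡ x * y + x * z
  distribˡ x y z = trans (*-comm x (y + z))
    (trans (distribʳ y z x) (cong₂ _+_ (*-comm y x) (*-comm z x)))

  isCommutativeRing : IsCommutativeRing _≡_ _+_ _*_ -_ 0# 1#
  isCommutativeRing = record
    { isRing = record
      { +-isAbelianGroup = record
        { isGroup = record
          { isMonoid = record
            { isSemigroup = record
              { isMagma = record { isEquivalence = isEquivalence ; ∙-cong = cong₂ _+_ }
              ; assoc = +-assoc }
            ; identity = +-identityˡ , +-identityʳ }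
          ; inverse = -‿inverseˡ , -‿inverseʳ
          ; ⁻¹-cong = cong (λ x → - x) }
        ; comm = +-comm }
      ; *-cong = cong₂ _*_
      ; *-assoc = *-assoc
      ; *-identity = *-identityˡ , *-identityʳ
      ; distrib = distribˡ , λ x y z → distribʳ y z x }
    ; *-comm = *-comm }

  commutativeRing : CommutativeRing 0ℓ 0ℓ
  commutativeRing = record { isCommutativeRing = isCommutativeRing }

  open SemiringSolver (CommutativeRing.commutativeSemiring commutativeRing) public
    using (solve; _:=_; _:+_; _:*_; con)

  x-y+y≡x : ∀ x y → (x - y) + y ≡ x
  x-y+y≡x x y = trans (+-assoc x (- y) y) (trans (cong (x +_) (-‿inverseˡ y)) (+-identityʳ x))

  x+y-y≡x : ∀ x y → (x + y) - y ≡ x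
  x+y-y≡x x y = trans (+-assoc x y (- y)) (trans (cong (x +_) (-‿inverseʳ y)) (+-identityʳ x))

  *-zeroʳ : ∀ x → x * 0# ≡ 0#
  *-zeroʳ x = begin
    x * 0#                          ≡⟨ sym (x+y-y≡x (x * 0#) (x * 0#)) ⟩
    (x * 0# + x * 0#) - (x * 0#)    ≡⟨ cong (_- (x * 0#)) (sym (distribˡ x 0# 0#)) ⟩
    (x * (0# + 0#)) - (x * 0#)      ≡⟨ cong (λ z → (x * z) - (x * 0#)) (+-identityˡ 0#) ⟩
    (x * 0#) - (x * 0#)             ≡⟨ -‿inverseʳ (x * 0#) ⟩
    0#                              ∎
    where open ≡-Reasoning

  ≤-reflexive : ∀ {x y} → x ≡ y → x ≤ y
  ≤-reflexive refl = ≤-refl _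

  isTotalOrder : IsTotalOrder _≡_ _≤_
  isTotalOrder = record
    { isPartialOrder = record
      { isPreorder = record { isEquivalence = isEquivalence ; reflexive = ≤-reflexive ; trans = ≤-trans }
      ; antisym = ≤-antisym }
    ; total = ≤-total }

  totalOrder : TotalOrder 0ℓ 0ℓ 0ℓ
  totalOrder = record { isTotalOrder = isTotalOrder }

  module ≤-Reasoning = PosetReasoning (TotalOrder.poset totalOrder)

  +-monoʳ-≤ : ∀ {x y} z → x ≤ y → z + x ≤ z + y
  +-monoʳ-≤ {x} {y} z x≤y = subst₂ _≤_ (+-comm x z) (+-comm y z) (+-mono-≤ z x≤y)

  +-mono-≤₂ : ∀ {x y u v} → x ≤ y → u ≤ v → x + u ≤ y + v
  +-mono-≤₂ {y = y} {u} x≤y u≤v = ≤-trans (+-mono-≤ u x≤y) (+-monoʳ-≤ y u≤v)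

  +-cancelʳ-≤ : ∀ {x y} z → x + z ≤ y + z → x ≤ y
  +-cancelʳ-≤ {x} {y} z h = subst₂ _≤_ (x+y-y≡x x z) (x+y-y≡x y z) (+-mono-≤ (- z) h)

  x≤x+y : ∀ x {y} → 0# ≤ y → x ≤ x + y
  x≤x+y x 0≤y = subst (_≤ x + _) (+-identityʳ x) (+-monoʳ-≤ x 0≤y)

  x≤y+x : ∀ x {y} → 0# ≤ y → x ≤ y + x
  x≤y+x x {y} 0≤y = subst (x ≤_) (+-comm x y) (x≤x+y x 0≤y)

  x+y≤z⇒y≤z-x : ∀ {x y z} → x + y ≤ z → y ≤ z - x
  x+y≤z⇒y≤z-x {x} {y} {z} h = subst (_≤ z - x) (x+y-y≡x y x) (+-mono-≤ (- x) (subst (_≤ z) (+-comm x y) h))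

  +-nonneg : ∀ {x y} → 0# ≤ x → 0# ≤ y → 0# ≤ x + y
  +-nonneg 0≤x 0≤y = ≤-trans 0≤x (x≤x+y _ 0≤y)

  x≤y⇒0≤y-x : ∀ {x y} → x ≤ y → 0# ≤ y - x
  x≤y⇒0≤y-x {x} {y} h = subst (_≤ y - x) (-‿inverseʳ x) (+-mono-≤ (- x) h)

  *-monoˡ-≤ : ∀ {c x y} → 0# ≤ c → x ≤ y → c * x ≤ c * y
  *-monoˡ-≤ {c} {x} {y} 0≤c x≤y = subst₂ _≤_ (+-identityˡ (c * x)) c[y-x]+cx≡cy
    (+-mono-≤ (c * x) (*-nonneg 0≤c (x≤y⇒0≤y-x x≤y)))
    where
    c[y-x]+cx≡cy : c * (y - x) + c * x ≡ c * y
    c[y-x]+cx≡cy = trans (sym (distribˡ c (y - x) x)) (cong (c *_) (x-y+y≡x y x))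

  0≤1 : 0# ≤ 1#
  0≤1 with ≤-total 0# 1#
  ... | inj₁ 0≤1 = 0≤1
  ... | inj₂ 1≤0 = subst (0# ≤_) [-1]*[-1]≡1 (*-nonneg 0≤-1 0≤-1)
    where
    0≤-1 : 0# ≤ - 1#
    0≤-1 = subst₂ _≤_ (-‿inverseʳ 1#) (+-identityˡ (- 1#)) (+-mono-≤ (- 1#) 1≤0)
    [-1]*[-1]+[-1]≡1+[-1] : (- 1#) * (- 1#) + (- 1#) ≡ 1# + (- 1#)
    [-1]*[-1]+[-1]≡1+[-1] = begin
      (- 1#) * (- 1#) + (- 1#)         ≡⟨ cong ((- 1#) * (- 1#) +_) (sym (*-identityʳ (- 1#))) ⟩
      (- 1#) * (- 1#) + (- 1#) * 1#    ≡⟨ sym (distribˡ (- 1#) (- 1#) 1#) ⟩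
      (- 1#) * (- 1# + 1#)             ≡⟨ cong ((- 1#) *_) (-‿inverseˡ 1#) ⟩
      (- 1#) * 0#                      ≡⟨ *-zeroʳ (- 1#) ⟩
      0#                               ≡⟨ sym (-‿inverseʳ 1#) ⟩
      1# + (- 1#)                      ∎
      where open ≡-Reasoning
    [-1]*[-1]≡1 : (- 1#) * (- 1#) ≡ 1#
    [-1]*[-1]≡1 = begin
      (- 1#) * (- 1#)                  ≡⟨ sym (x+y-y≡x _ (- 1#)) ⟩
      ((- 1#) * (- 1#) + (- 1#)) - (- 1#) ≡⟨ cong (_- (- 1#)) [-1]*[-1]+[-1]≡1+[-1] ⟩
      (1# + (- 1#)) - (- 1#)           ≡⟨ x+y-y≡x 1# (- 1#) ⟩
      1#                               ∎
      where open ≡-Reasoning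

  bounded-ray⇒≤0 : ∀ e b → (∀ W → 0# ≤ W → e * W ≤ b) → e ≤ 0#
  bounded-ray⇒≤0 e b eW≤b = +-cancelʳ-≤ s (subst₂ _≤_ (+-comm s e) s-e+e≡0+s (+-mono-≤ e s≤s-e))
    where
    Values : ℝ → Set
    Values x = Σ ℝ λ W → 0# ≤ W × x ≡ e * W
    supremum = sup Values (e * 0# , 0# , ≤-refl 0# , refl) (b , λ { _ (W , 0≤W , refl) → eW≤b W 0≤W })
    s = proj₁ supremum
    -- e * W ≤ s - e because e * (W + 1) is itself a value
    s-e-upper : ∀ x → Values x → x ≤ s - e
    s-e-upper _ (W , 0≤W , refl) = subst (_≤ s - e) (x+y-y≡x (e * W) e)
      (+-mono-≤ (- e) (subst (_≤ s) (trans (distribˡ e W 1#) (cong (e * W +_) (*-identityʳ e)))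
        (proj₁ (proj₂ supremum) _ (W + 1# , +-nonneg 0≤W 0≤1 , refl))))
    s≤s-e : s ≤ s - e
    s≤s-e = proj₂ (proj₂ supremum) (s - e) s-e-upper
    s-e+e≡0+s : (s - e) + e ≡ 0# + s
    s-e+e≡0+s = trans (x-y+y≡x s e) (sym (+-identityˡ s))

  slope≤1 : ∀ a b → (∀ W → 0# ≤ W → a * W ≤ b + W) → a ≤ 1#
  slope≤1 a b aW≤b+W = subst₂ _≤_ (x-y+y≡x a 1#) (+-identityˡ 1#)
    (+-mono-≤ 1# (bounded-ray⇒≤0 (a - 1#) b λ W 0≤W → +-cancelʳ-≤ W
      (subst (_≤ b + W) (sym [a-1]W+W≡aW) (aW≤b+W W 0≤W))))
    where
    [a-1]W+W≡aW : ∀ {W} → (a - 1#) * W + W ≡ a * W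
    [a-1]W+W≡aW {W} = begin
      (a - 1#) * W + W          ≡⟨ cong ((a - 1#) * W +_) (sym (*-identityˡ W)) ⟩
      (a - 1#) * W + 1# * W     ≡⟨ sym (distribʳ (a - 1#) 1# W) ⟩
      ((a - 1#) + 1#) * W       ≡⟨ cong (_* W) (x-y+y≡x a 1#) ⟩
      a * W                     ∎
      where open ≡-Reasoning

module MaxWeightMatching (F : RealField) where
  open RealField F
  open TwoStage F
  open OrderedFieldProperties F
  open import Data.Vec.Functional using (_∷_; tail)
  open Data.List.Extrema totalOrder using (argmax; f[⊥]≤f[argmax]; f[xs]≤f[argmax]; argmax-all)

  weight-nonneg : ∀ {n s} {w : EdgeW n s} → NonNeg w → ∀ m → 0# ≤ weight w m
  weight-nonneg {zero} nn m = ≤-refl 0#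
  weight-nonneg {suc n} {w = w} nn m =
    +-nonneg (head-nonneg (m zero)) (weight-nonneg (λ i → nn (suc i)) (tail m))
    where
    head-nonneg : ∀ o → 0# ≤ matchVal (w zero) o
    head-nonneg nothing = ≤-refl 0#
    head-nonneg (just j) with w zero j in e
    ... | nothing = ≤-refl 0#
    ... | just x = nn zero j x e

  isMatching-anti : ∀ {n s} {w : EdgeW n s} {U V : Pred (Fin s) 0ℓ} {m} →
                    (∀ j → V j → U j) → IsMatching w U m → IsMatching w V m
  isMatching-anti V⊆U isM = record
    { onEdges = onEdges ; injective = injective ; avoids = λ i j e v → avoids i j e (V⊆U j v) }
    where open IsMatching isM

  tail-isMatching : ∀ {n s} {w : EdgeW (suc n) s} {U : Pred (Fin s) 0ℓ} {m} → IsMatching w U m →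
                    IsMatching (tail w) (λ k → m zero ≡ just k ⊎ U k) (tail m)
  tail-isMatching {m = m} isM = record
    { onEdges = λ i → onEdges (suc i)
    ; injective = λ i i′ j e e′ → suc-injective (injective (suc i) (suc i′) j e e′)
    ; avoids = λ { i j e (inj₁ e₀) → 0≢1+n (injective zero (suc i) j e₀ e)
                 ; i j e (inj₂ u) → avoids (suc i) j e u } }
    where open IsMatching isM

  nothing∷-isMatching : ∀ {n s} {w : EdgeW (suc n) s} {U : Pred (Fin s) 0ℓ} {m} →
                        IsMatching (tail w) U m → IsMatching w U (nothing ∷ m)
  nothing∷-isMatching isM = record
    { onEdges = λ { zero _ () ; (suc i) → onEdges i }
    ; injective = λ { zero _ _ () _ ; (suc i) zero _ _ () ; (suc i) (suc i′) j e e′ → cong suc (injective i i′ j e e′) }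
    ; avoids = λ { zero _ () ; (suc i) → avoids i } }
    where open IsMatching isM

  just∷-isMatching : ∀ {n s} {w : EdgeW (suc n) s} {U : Pred (Fin s) 0ℓ} {m j r} →
                     ¬ U j → w zero j ≡ just r → IsMatching (tail w) (｛ j ｝ ∪ U) m →
                     IsMatching w U (just j ∷ m)
  just∷-isMatching {m = m} {j} {r} ¬Uj wj≡r isM = record
    { onEdges = λ { zero _ refl → r , wj≡r ; (suc i) → onEdges i }
    ; injective = injective′
    ; avoids = λ { zero _ refl → ¬Uj ; (suc i) k e u → avoids i k e (inj₂ u) } }
    where
    open IsMatching isM
    injective′ : ∀ i i′ k → (just j ∷ m) i ≡ just k → (just j ∷ m) i′ ≡ just k → i ≡ i′
    injective′ zero zero _ _ _ = refl
    injective′ zero (suc i′) _ refl e′ = ⊥-elim (avoids i′ j e′ (inj₁ refl))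
    injective′ (suc i) zero _ e refl = ⊥-elim (avoids i j e (inj₁ refl))
    injective′ (suc i) (suc i′) k e e′ = cong suc (injective i i′ k e e′)

  -- Brute force over the choices for the first online vertex: leave it
  -- unmatched, or match it to some offline vertex j and recurse with j removed.
  mutual
    maxMatching : ∀ {n s} (w : EdgeW n s) {U : Pred (Fin s) 0ℓ} → Decidable U → Assign n s
    maxMatching {zero} w U? = λ ()
    maxMatching {suc n} {s} w U? = argmax (weight w) (skipHead w U?) (tabulate (matchHeadTo w U?))

    skipHead : ∀ {n s} (w : EdgeW (suc n) s) {U : Pred (Fin s) 0ℓ} → Decidable U → Assign (suc n) s
    skipHead w U? = nothing ∷ maxMatching (tail w) U?

    matchHeadTo : ∀ {n s} (w : EdgeW (suc n) s) {U : Pred (Fin s) 0ℓ} → Decidable U → Fin s → Assign (suc n) s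
    matchHeadTo w U? j with U? j | w zero j
    ... | no _ | just _ = just j ∷ maxMatching (tail w) ((j ≟_) ∪? U?)
    ... | _    | _      = skipHead w U?

  matchHeadTo-available : ∀ {n s} (w : EdgeW (suc n) s) {U : Pred (Fin s) 0ℓ} (U? : Decidable U) {j r} →
                          ¬ U j → w zero j ≡ just r →
                          matchHeadTo w U? j ≡ just j ∷ maxMatching (tail w) ((j ≟_) ∪? U?)
  matchHeadTo-available w U? {j} ¬Uj wj≡r with U? j
  ... | yes Uj = ⊥-elim (¬Uj Uj)
  ... | no _ rewrite wj≡r = refl

  mutual
    maxMatching-isMatching : ∀ {n s} (w : EdgeW n s) {U : Pred (Fin s) 0ℓ} (U? : Decidable U) →
                             IsMatching w U (maxMatching w U?)
    maxMatching-isMatching {zero} w U? = record { onEdges = λ () ; injective = λ () ; avoids = λ () }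
    maxMatching-isMatching {suc n} w U? =
      argmax-all (weight w) {P = IsMatching w _} (skipHead-isMatching w U?) (tabulate⁺ (matchHeadTo-isMatching w U?))

    skipHead-isMatching : ∀ {n s} (w : EdgeW (suc n) s) {U : Pred (Fin s) 0ℓ} (U? : Decidable U) →
                          IsMatching w U (skipHead w U?)
    skipHead-isMatching w U? = nothing∷-isMatching (maxMatching-isMatching (tail w) U?)

    matchHeadTo-isMatching : ∀ {n s} (w : EdgeW (suc n) s) {U : Pred (Fin s) 0ℓ} (U? : Decidable U) j →
                             IsMatching w U (matchHeadTo w U? j)
    matchHeadTo-isMatching w U? j with U? j | w zero j in wj≡r
    ... | no ¬Uj | just _  = just∷-isMatching ¬Uj wj≡r (maxMatching-isMatching (tail w) ((j ≟_) ∪? U?))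
    ... | no _   | nothing = skipHead-isMatching w U?
    ... | yes _  | _       = skipHead-isMatching w U?

  maxMatching-optimal : ∀ {n s} (w : EdgeW n s) {U : Pred (Fin s) 0ℓ} (U? : Decidable U) {m} →
                        IsMatching w U m → weight w m ≤ weight w (maxMatching w U?)
  maxMatching-optimal {zero} w U? isM = ≤-refl 0#
  maxMatching-optimal {suc n} w U? {m} isM with m zero in m₀≡ | tail-isMatching isM
  ... | nothing | isM′ = begin
      0# + weight (tail w) (tail m)
        ≤⟨ +-monoʳ-≤ 0# (maxMatching-optimal (tail w) U? (isMatching-anti (λ _ → inj₂) isM′)) ⟩
      weight w (skipHead w U?)
        ≤⟨ f[⊥]≤f[argmax] {f = weight w} (skipHead w U?) (tabulate (matchHeadTo w U?)) ⟩
      weight w (maxMatching w U?) ∎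
    where open ≤-Reasoning
  ... | just j | isM′ = begin
      edgeVal (w zero j) + weight (tail w) (tail m)
        ≤⟨ +-monoʳ-≤ _ (maxMatching-optimal (tail w) ((j ≟_) ∪? U?) (isMatching-anti j-or-U isM′)) ⟩
      weight w (just j ∷ maxMatching (tail w) ((j ≟_) ∪? U?))
        ≡⟨ cong (weight w) (sym (matchHeadTo-available w U? ¬Uj wj≡r)) ⟩
      weight w (matchHeadTo w U? j)
        ≤⟨ tabulate⁻ (f[xs]≤f[argmax] {f = weight w} (skipHead w U?) _) j ⟩
      weight w (maxMatching w U?) ∎
    where
    open ≤-Reasoning
    ¬Uj = IsMatching.avoids isM zero j m₀≡
    wj≡r = proj₂ (IsMatching.onEdges isM zero j m₀≡)
    j-or-U : ∀ k → (j ≡ k ⊎ _) → (just j ≡ just k ⊎ _)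
    j-or-U k (inj₁ refl) = inj₁ refl
    j-or-U k (inj₂ u) = inj₂ u

  emptyMatching : ∀ {n s} (w : EdgeW n s) → Matching1 w
  emptyMatching w = (λ _ → nothing) , record { onEdges = λ _ _ () ; injective = λ _ _ _ () ; avoids = λ _ _ () }

  maxMatching₁ : ∀ {n s} (w : EdgeW n s) → Matching1 w
  maxMatching₁ w = maxMatching w ∅? , maxMatching-isMatching w ∅?

  maxMatching₁-optimal : ∀ {n s} (w : EdgeW n s) (M : Matching1 w) →
                         weight w (proj₁ M) ≤ weight w (proj₁ (maxMatching₁ w))
  maxMatching₁-optimal w (m , isM) = maxMatching-optimal w ∅? isM

  uses? : ∀ {n s} (m : Assign n s) → Decidable (Uses m)
  uses? m j = any? (λ i → ≡-dec _≟_ (m i) (just j))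

  maxMatching₂ : ∀ {n₁ n₂ s} {w₁ : EdgeW n₁ s} (M₁ : Matching1 w₁) (w₂ : EdgeW n₂ s) → Matching2 w₂ M₁
  maxMatching₂ (m₁ , _) w₂ = maxMatching w₂ (uses? m₁) , maxMatching-isMatching w₂ (uses? m₁)

  maxMatching₂-optimal : ∀ {n₁ n₂ s} {w₁ : EdgeW n₁ s} (M₁ : Matching1 w₁) (w₂ : EdgeW n₂ s)
                         (M₂ : Matching2 w₂ M₁) → weight w₂ (proj₁ M₂) ≤ weight w₂ (proj₁ (maxMatching₂ M₁ w₂))
  maxMatching₂-optimal (m₁ , _) w₂ (_ , isM) = maxMatching-optimal w₂ (uses? m₁) isM

  maxMatching₂-after-empty-optimal : ∀ {n₁ n₂ s} {w₁ : EdgeW n₁ s} (M₁ : Matching1 w₁) (w₂ : EdgeW n₂ s)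
    (M₂ : Matching2 w₂ M₁) → weight w₂ (proj₁ M₂) ≤ weight w₂ (proj₁ (maxMatching₂ (emptyMatching w₁) w₂))
  maxMatching₂-after-empty-optimal {w₁ = w₁} M₁ w₂ (m₂ , isM) =
    maxMatching₂-optimal (emptyMatching w₁) w₂ (m₂ , isMatching-anti (λ { _ (_ , ()) }) isM)

module Expectation (F : RealField) where
  open Data.List using ([]; _∷_)
  open Data.List.Relation.Unary.All using ([]; _∷_)
  open RealField F
  open TwoStage F
  open OrderedFieldProperties F

  mass : ∀ {A : Set} → Dist A → ℝ
  mass d = sumList (Data.List.map proj₁ d)

  Expect-cong : ∀ {A : Set} {f g : A → ℝ} (d : Dist A) → (∀ x → f x ≡ g x) → Expect f d ≡ Expect g d
  Expect-cong [] f≡g = refl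
  Expect-cong ((p , x) ∷ d) f≡g = cong₂ _+_ (cong (p *_) (f≡g x)) (Expect-cong d f≡g)

  Expect-mono : ∀ {A : Set} {f g : A → ℝ} (d : Dist A) → All (λ q → 0# ≤ proj₁ q) d →
                (∀ x → f x ≤ g x) → Expect f d ≤ Expect g d
  Expect-mono [] [] f≤g = ≤-refl 0#
  Expect-mono ((p , x) ∷ d) (0≤p ∷ 0≤d) f≤g = +-mono-≤₂ (*-monoˡ-≤ 0≤p (f≤g x)) (Expect-mono d 0≤d f≤g)

  Expect-+ : ∀ {A : Set} (f g : A → ℝ) (d : Dist A) → Expect (λ x → f x + g x) d ≡ Expect f d + Expect g d
  Expect-+ f g [] = sym (+-identityʳ 0#)
  Expect-+ f g ((p , x) ∷ d) = trans (cong (p * (f x + g x) +_) (Expect-+ f g d))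
    (solve 5 (λ p fx gx Ef Eg → p :* (fx :+ gx) :+ (Ef :+ Eg) := (p :* fx :+ Ef) :+ (p :* gx :+ Eg))
       refl p (f x) (g x) (Expect f d) (Expect g d))

  Expect-*ʳ : ∀ {A : Set} (f : A → ℝ) c (d : Dist A) → Expect (λ x → f x * c) d ≡ Expect f d * c
  Expect-*ʳ f c [] = sym (trans (*-comm 0# c) (*-zeroʳ c))
  Expect-*ʳ f c ((p , x) ∷ d) = trans (cong (p * (f x * c) +_) (Expect-*ʳ f c d))
    (solve 4 (λ p fx c Ef → p :* (fx :* c) :+ Ef :* c := (p :* fx :+ Ef) :* c) refl p (f x) c (Expect f d))

  Expect-const : ∀ {A : Set} c (d : Dist A) → Expect (λ _ → c) d ≡ c * mass d
  Expect-const c [] = sym (*-zeroʳ c)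
  Expect-const c ((p , x) ∷ d) = trans (cong (p * c +_) (Expect-const c d))
    (solve 3 (λ p c m → p :* c :+ c :* m := c :* (p :+ m)) refl p c (mass d))

  Expect-0 : ∀ {A : Set} (d : Dist A) → Expect (λ _ → 0#) d ≡ 0#
  Expect-0 d = trans (Expect-const 0# d) (trans (*-comm 0# (mass d)) (*-zeroʳ (mass d)))

  Expect-const-dist : ∀ {A : Set} c {d : Dist A} → IsDist d → Expect (λ _ → c) d ≡ c
  Expect-const-dist c {d} (_ , mass≡1) = trans (Expect-const c d) (trans (cong (c *_) mass≡1) (*-identityʳ c))

module Hedging (F : RealField) where
  open Data.List using ([]; _∷_)
  open Data.List.Relation.Unary.All using ([]; _∷_)
  open RealField F
  open TwoStage F
  open OrderedFieldProperties F
  open MaxWeightMatching F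

  module _ (R : ℝ) (0≤R : 0# ≤ R) (R+R≤1 : R + R ≤ 1#) where
    q : ℝ
    q = (1# - R) - R

    q+R≡1-R : q + R ≡ 1# - R
    q+R≡1-R = x-y+y≡x (1# - R) R

    0≤q : 0# ≤ q
    0≤q = x≤y⇒0≤y-x (x+y≤z⇒y≤z-x R+R≤1)

    mass≡1 : R + (R + (q + 0#)) ≡ 1#
    mass≡1 = begin
      R + (R + (q + 0#))  ≡⟨ solve 2 (λ R q → R :+ (R :+ (q :+ con 0)) := (q :+ R) :+ R) refl R q ⟩
      (q + R) + R         ≡⟨ cong (_+ R) q+R≡1-R ⟩
      (1# - R) + R        ≡⟨ x-y+y≡x 1# R ⟩
      1#                  ∎
      where open ≡-Reasoning

    hedging : Algorithm
    hedging = record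
      { stage1 = λ w₁ A → (R , emptyMatching w₁) ∷ (R , maxMatching₁ w₁) ∷ (q , A) ∷ []
      ; stage2 = λ w₁ A M₁ w₂ → (1# , maxMatching₂ M₁ w₂) ∷ []
      ; stage1-valid = λ w₁ A _ → (0≤R ∷ 0≤R ∷ 0≤q ∷ []) , mass≡1
      ; stage2-valid = λ w₁ A M₁ w₂ _ _ → (0≤1 ∷ []) , +-identityʳ 1#
      }

    module _ {n₁ n₂ s} (w₁ : EdgeW n₁ s) (w₂ : EdgeW n₂ s) (nn₁ : NonNeg w₁) (nn₂ : NonNeg w₂)
             (A : Matching1 w₁) where
      total : Matching1 w₁ → ℝ
      total M₁ = weight w₁ (proj₁ M₁) + weight w₂ (proj₁ (maxMatching₂ M₁ w₂))

      ALG-hedging : ALG hedging w₁ w₂ A ≡ R * total (emptyMatching w₁) + (R * total (maxMatching₁ w₁) + q * total A)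
      ALG-hedging = solve 8
        (λ R q a₀ b₀ a₁ b₁ a₂ b₂ →
          R :* (a₀ :+ (con 1 :* b₀ :+ con 0)) :+ (R :* (a₁ :+ (con 1 :* b₁ :+ con 0)) :+ (q :* (a₂ :+ (con 1 :* b₂ :+ con 0)) :+ con 0))
          := R :* (a₀ :+ b₀) :+ (R :* (a₁ :+ b₁) :+ q :* (a₂ :+ b₂)))
        refl R q _ _ _ _ _ _

      ALG-hedging-≥ : ∀ {x y z} → x ≤ total (emptyMatching w₁) → y ≤ total (maxMatching₁ w₁) → z ≤ total A →
                      R * x + (R * y + q * z) ≤ ALG hedging w₁ w₂ A
      ALG-hedging-≥ {x} {y} {z} x≤ y≤ z≤ = subst (R * x + (R * y + q * z) ≤_) (sym ALG-hedging)
        (+-mono-≤₂ (*-monoˡ-≤ 0≤R x≤) (+-mono-≤₂ (*-monoˡ-≤ 0≤R y≤) (*-monoˡ-≤ 0≤q z≤)))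

      total-nonneg : (M₁ : Matching1 w₁) → 0# ≤ total M₁
      total-nonneg M₁ = +-nonneg (weight-nonneg nn₁ (proj₁ M₁)) (weight-nonneg nn₂ (proj₁ (maxMatching₂ M₁ w₂)))

      second-stage≤total-empty : (M₁ : Matching1 w₁) (M₂ : Matching2 w₂ M₁) → weight w₂ (proj₁ M₂) ≤ total (emptyMatching w₁)
      second-stage≤total-empty M₁ M₂ = ≤-trans (maxMatching₂-after-empty-optimal M₁ w₂ M₂)
        (x≤y+x _ (weight-nonneg nn₁ (proj₁ (emptyMatching w₁))))

      first-stage≤total-max : (M₁ : Matching1 w₁) → weight w₁ (proj₁ M₁) ≤ total (maxMatching₁ w₁)
      first-stage≤total-max M₁ = ≤-trans (maxMatching₁-optimal w₁ M₁)
        (x≤x+y _ (weight-nonneg nn₂ (proj₁ (maxMatching₂ (maxMatching₁ w₁) w₂))))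

      hedging-robust : (M₁ : Matching1 w₁) (M₂ : Matching2 w₂ M₁) →
                       R * (weight w₁ (proj₁ M₁) + weight w₂ (proj₁ M₂)) ≤ ALG hedging w₁ w₂ A
      hedging-robust M₁ M₂ = begin
        R * (a + b)                ≡⟨ solve 4 (λ R q a b → R :* (a :+ b) := R :* b :+ (R :* a :+ q :* con 0)) refl R q a b ⟩
        R * b + (R * a + q * 0#)   ≤⟨ ALG-hedging-≥ (second-stage≤total-empty M₁ M₂) (first-stage≤total-max M₁) (total-nonneg A) ⟩
        ALG hedging w₁ w₂ A        ∎
        where
        open ≤-Reasoning
        a = weight w₁ (proj₁ M₁)
        b = weight w₂ (proj₁ M₂)

      hedging-consistent : (M₂ : Matching2 w₂ A) →
                           (1# - R) * (weight w₁ (proj₁ A) + weight w₂ (proj₁ M₂)) ≤ ALG hedging w₁ w₂ A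
      hedging-consistent M₂ = begin
        (1# - R) * (a + b)              ≡⟨ cong (_* (a + b)) (sym q+R≡1-R) ⟩
        (q + R) * (a + b)               ≡⟨ solve 4 (λ R q a b → (q :+ R) :* (a :+ b) := R :* b :+ (R :* a :+ q :* (a :+ b))) refl R q a b ⟩
        R * b + (R * a + q * (a + b))   ≤⟨ ALG-hedging-≥ (second-stage≤total-empty A M₂) (first-stage≤total-max A)
                                             (+-monoʳ-≤ a (maxMatching₂-optimal A w₂ M₂)) ⟩
        ALG hedging w₁ w₂ A             ∎
        where
        open ≤-Reasoning
        a = weight w₁ (proj₁ A)
        b = weight w₂ (proj₁ M₂)

    hedging-robust-consistent : Robust hedging R × Consistent hedging (1# - R)
    hedging-robust-consistent =
      (λ w₁ w₂ nn₁ nn₂ A → hedging-robust w₁ w₂ nn₁ nn₂ A) , (λ w₁ w₂ nn₁ nn₂ A → hedging-consistent w₁ w₂ nn₁ nn₂ A)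

module LowerBound (F : RealField) where
  open RealField F
  open TwoStage F
  open OrderedFieldProperties F
  open MaxWeightMatching F
  open Expectation F

  singleEdge : ℝ → EdgeW 1 1
  singleEdge W _ _ = just W

  singleEdge-nonneg : ∀ {W} → 0# ≤ W → NonNeg (singleEdge W)
  singleEdge-nonneg 0≤W _ _ _ refl = 0≤W

  noEdges : EdgeW 0 1
  noEdges ()

  noEdges-nonneg : NonNeg noEdges
  noEdges-nonneg ()

  fullMatching : Matching1 (singleEdge 1#)
  fullMatching = (λ _ → just zero) , record
    { onEdges = λ _ _ _ → 1# , refl ; injective = λ { zero zero _ _ _ → refl } ; avoids = λ _ _ _ () }

  noMatching : (M₁ : Matching1 (singleEdge 1#)) → Matching2 noEdges M₁
  noMatching _ = (λ ()) , record { onEdges = λ () ; injective = λ () ; avoids = λ () }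

  secondStageEdge : ∀ W → Matching2 (singleEdge W) (emptyMatching (singleEdge 1#))
  secondStageEdge W = (λ _ → just zero) , record
    { onEdges = λ _ _ _ → W , refl ; injective = λ { zero zero _ _ _ → refl } ; avoids = λ { _ _ _ (_ , ()) } }

  module _ (a : Algorithm) where
    open Algorithm a

    -- the edge has weight 1, so this is the probability p of using it
    matchedProb : Matching1 (singleEdge 1#) → ℝ
    matchedProb A = Expect (λ M₁ → weight (singleEdge 1#) (proj₁ M₁)) (stage1 (singleEdge 1#) A)

    ALG-noEdges : ∀ A → ALG a (singleEdge 1#) noEdges A ≡ matchedProb A
    ALG-noEdges A = Expect-cong (stage1 (singleEdge 1#) A) λ M₁ →
      trans (cong (weight (singleEdge 1#) (proj₁ M₁) +_) (Expect-0 (stage2 (singleEdge 1#) A M₁ noEdges)))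
            (+-identityʳ _)

    module _ {W} (0≤W : 0# ≤ W) (A : Matching1 (singleEdge 1#)) where
      first : Matching1 (singleEdge 1#) → ℝ
      first M₁ = weight (singleEdge 1#) (proj₁ M₁)

      outcome : Matching1 (singleEdge 1#) → ℝ
      outcome M₁ = first M₁ + Expect (λ M₂ → weight (singleEdge W) (proj₁ M₂)) (stage2 (singleEdge 1#) A M₁ (singleEdge W))

      outcome-bound : ∀ M₁ → outcome M₁ + first M₁ * W ≤ first M₁ + W
      outcome-bound M₁ with proj₁ M₁ zero in m₀≡
      ... | just zero = ≤-reflexive (trans
              (cong (λ z → ((1# + 0#) + z) + (1# + 0#) * W) (trans (Expect-cong d second-stage-blocked) (Expect-0 d)))
              (solve 1 (λ W → ((con 1 :+ con 0) :+ con 0) :+ (con 1 :+ con 0) :* W := (con 1 :+ con 0) :+ W) refl W))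
        where
        d = stage2 (singleEdge 1#) A M₁ (singleEdge W)
        second-stage-blocked : ∀ (M₂ : Matching2 (singleEdge W) M₁) → weight (singleEdge W) (proj₁ M₂) ≡ 0#
        second-stage-blocked (m₂ , isM) with m₂ zero in m₂₀≡
        ... | nothing = +-identityʳ 0#
        ... | just zero = ⊥-elim (IsMatching.avoids isM zero zero m₂₀≡ (zero , m₀≡))
      ... | nothing = begin
          ((0# + 0#) + X) + (0# + 0#) * W   ≡⟨ solve 2 (λ X W → ((con 0 :+ con 0) :+ X) :+ (con 0 :+ con 0) :* W := X) refl X W ⟩
          X                                 ≤⟨ Expect-mono d (proj₁ d-valid) (λ M₂ → weight≤W (proj₁ M₂)) ⟩
          Expect (λ _ → W) d                ≡⟨ Expect-const-dist W d-valid ⟩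
          W                                 ≡⟨ sym (+-identityˡ W) ⟩
          0# + W                            ≡⟨ cong (_+ W) (sym (+-identityʳ 0#)) ⟩
          (0# + 0#) + W                     ∎
        where
        open ≤-Reasoning
        d = stage2 (singleEdge 1#) A M₁ (singleEdge W)
        d-valid = stage2-valid (singleEdge 1#) A M₁ (singleEdge W) (singleEdge-nonneg 0≤1) (singleEdge-nonneg 0≤W)
        X = Expect (λ M₂ → weight (singleEdge W) (proj₁ M₂)) d
        weight≤W : ∀ m → weight (singleEdge W) m ≤ W
        weight≤W m with m zero
        ... | just zero = ≤-reflexive (+-identityʳ W)
        ... | nothing = ≤-trans (≤-reflexive (+-identityʳ 0#)) 0≤W

      ALG-singleEdge : ALG a (singleEdge 1#) (singleEdge W) A + matchedProb A * W ≤ matchedProb A + W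
      ALG-singleEdge = begin
        Expect outcome d + Expect first d * W        ≡⟨ cong (Expect outcome d +_) (sym (Expect-*ʳ first W d)) ⟩
        Expect outcome d + Expect (λ M₁ → first M₁ * W) d
                                                      ≡⟨ sym (Expect-+ outcome (λ M₁ → first M₁ * W) d) ⟩
        Expect (λ M₁ → outcome M₁ + first M₁ * W) d  ≤⟨ Expect-mono d (proj₁ d-valid) outcome-bound ⟩
        Expect (λ M₁ → first M₁ + W) d               ≡⟨ Expect-+ first (λ _ → W) d ⟩
        Expect first d + Expect (λ _ → W) d          ≡⟨ cong (Expect first d +_) (Expect-const-dist W d-valid) ⟩
        Expect first d + W                            ∎
        where
        open ≤-Reasoning
        d = stage1 (singleEdge 1#) A
        d-valid = stage1-valid (singleEdge 1#) A (singleEdge-nonneg 0≤1)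

    robust⇒≤matchedProb : ∀ {R} → Robust a R → ∀ A → R ≤ matchedProb A
    robust⇒≤matchedProb {R} robust A = begin
      R                     ≡⟨ solve 1 (λ R → R := R :* ((con 1 :+ con 0) :+ con 0)) refl R ⟩
      R * ((1# + 0#) + 0#)  ≤⟨ robust (singleEdge 1#) noEdges (singleEdge-nonneg 0≤1) noEdges-nonneg A fullMatching (noMatching fullMatching) ⟩
      ALG a (singleEdge 1#) noEdges A ≡⟨ ALG-noEdges A ⟩
      matchedProb A         ∎
      where open ≤-Reasoning

    robust⇒+matchedProb≤1 : ∀ {R} → Robust a R → ∀ A → R + matchedProb A ≤ 1#
    robust⇒+matchedProb≤1 {R} robust A = slope≤1 (R + p) p λ W 0≤W → begin
      (R + p) * W                          ≡⟨ distribʳ R p W ⟩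
      R * W + p * W                        ≡⟨ cong (_+ p * W) (solve 2 (λ R W → R :* W := R :* ((con 0 :+ con 0) :+ (W :+ con 0))) refl R W) ⟩
      R * ((0# + 0#) + (W + 0#)) + p * W   ≤⟨ +-mono-≤ (p * W) (robust (singleEdge 1#) (singleEdge W) (singleEdge-nonneg 0≤1) (singleEdge-nonneg 0≤W)
                                                A (emptyMatching (singleEdge 1#)) (secondStageEdge W)) ⟩
      ALG a (singleEdge 1#) (singleEdge W) A + p * W ≤⟨ ALG-singleEdge 0≤W A ⟩
      p + W                                ∎
      where
      open ≤-Reasoning
      p = matchedProb A

    consistent⇒≤matchedProb : ∀ {C} → Consistent a C → C ≤ matchedProb fullMatching
    consistent⇒≤matchedProb {C} consistent = begin
      C                     ≡⟨ solve 1 (λ C → C := C :* ((con 1 :+ con 0) :+ con 0)) refl C ⟩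
      C * ((1# + 0#) + 0#)  ≤⟨ consistent (singleEdge 1#) noEdges (singleEdge-nonneg 0≤1) noEdges-nonneg fullMatching (noMatching fullMatching) ⟩
      ALG a (singleEdge 1#) noEdges fullMatching ≡⟨ ALG-noEdges fullMatching ⟩
      matchedProb fullMatching ∎
      where open ≤-Reasoning

    robust⇒R+R≤1 : ∀ {R} → Robust a R → R + R ≤ 1#
    robust⇒R+R≤1 {R} robust = ≤-trans (+-monoʳ-≤ R (robust⇒≤matchedProb robust A)) (robust⇒+matchedProb≤1 robust A)
      where A = emptyMatching (singleEdge 1#)

    robust-consistent⇒C≤1-R : ∀ {R C} → Robust a R → Consistent a C → C ≤ 1# - R
    robust-consistent⇒C≤1-R robust consistent =
      ≤-trans (consistent⇒≤matchedProb consistent) (x+y≤z⇒y≤z-x (robust⇒+matchedProb≤1 robust fullMatching))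

proposition2 : (F : RealField) →
    let open RealField F
        open TwoStage F
    in ((R : ℝ) → 0# ≤ R → R + R ≤ 1# →
          Σ Algorithm (λ a → Robust a R × Consistent a (1# - R)))
       × ((a : Algorithm) (R : ℝ) → Robust a R → R + R ≤ 1#)
       × ((a : Algorithm) (R C : ℝ) → Robust a R → Consistent a C → C ≤ 1# - R)
proposition2 F =
    (λ R 0≤R R+R≤1 → hedging R 0≤R R+R≤1 , hedging-robust-consistent R 0≤R R+R≤1)
  , (λ a R → robust⇒R+R≤1 a)
  , (λ a R C → robust-consistent⇒C≤1-R a)
  where
  open Hedging F
  open LowerBound F
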